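{- Let $D = (P, \mathcal{B})$ be a $2$-$(v, k,\lambda)$ design with $b$ blocks and $r$ blocks through each point, and let $G=G_D$ be its incidence graph. Let $m$ be any positive integer. Then for any $X \subseteq P$ and $Y \subseteq \mathcal{B}$, \[ |N(X)| \ge \frac{2rm-\lambda (|X|-1)}{m(m+1)}|X|;\qquad |N(X)| \ge \frac{r^2}{r + \lambda(|X|-1)}|X|; \] \[ |N(Y)| \ge \frac{rk}{r^2-\lambda(b-|Y|)}|Y|;\qquad |N(X) \setminus Y| \ge \frac{4\lambda}{k^2}|X|\,|P \setminus (X \cup N(Y))|. \] Moreover, equality holds in the first inequality if every block in $N(X)$ contains exactly $m$ or $m+1$ points of $X$.
   Context: Given positive integers $v>k>\lambda$, a $2$-$(v,k,\lambda)$ design is a pair $(P,\mathcal{B})$ where $P$ is a set of $v$ points and $\mathcal{B}$ is a set of $k$-subsets of $P$ (blocks) such that every $2$-subset of $P$ is contained in exactly $\lambda$ blocks. The incidence graph $G_D$ is the bipartite graph on $P\cup\mathcal{B}$ with $p$ adjacent to $B$ iff $p\in B$. For $S$ a set of vertices, $N(S)$ denotes the set of vertices not in $S$ adjacent to at least one vertex of $S$ (in $G_D$). -}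

module Defs where

open import Data.Nat using (ℕ; suc; _<_)
open import Data.Fin using (Fin)
open import Data.Fin.Subset using (Subset; inside; outside; _∈_; _∩_; _∪_; ∣_∣)
open import Data.Fin.Subset.Properties using (_∈?_; nonempty?)
open import Data.Vec using (tabulate)
open import Data.Product using (_×_)
open import Function.Definitions using (Injective)
open import Relation.Binary.PropositionalEquality using (_≡_; _≢_)
open import Relation.Nullary using (Dec; does)
open import Relation.Nullary.Decidable using (_×-dec_)
open import Data.Bool using (if_then_else_)

select : ∀ {n} {P : Fin n → Set} → ((i : Fin n) → Dec (P i)) → Subset n
select P? = tabulate (λ i → if does (P? i) then inside else outside)

-- A 2-(v,k,λ) design with b blocks: point set Fin v, blocks given by an
-- injective family Fin b → Subset v (so the blocks form a SET of b k-subsets).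
record IsDesign (v k lam b : ℕ) (B : Fin b → Subset v) : Set where
  field
    0<λ     : 0 < lam
    lam<k     : lam < k
    k<v     : k < v
    distinct : Injective _≡_ _≡_ B
    blockSize : ∀ j → ∣ B j ∣ ≡ k
    pairs   : ∀ p q → p ≢ q →
              ∣ select (λ j → (p ∈? B j) ×-dec (q ∈? B j)) ∣ ≡ lam

blocksThrough : ∀ {v b} → (Fin b → Subset v) → Fin v → Subset b
blocksThrough B p = select (λ j → p ∈? B j)

-- Neighbourhoods in the incidence graph G_D.
-- N(X) for a set X of points: the blocks meeting X.
NP : ∀ {v b} → (Fin b → Subset v) → Subset v → Subset b
NP B X = select (λ j → nonempty? (X ∩ B j))

NB : ∀ {v b} → (Fin b → Subset v) → Subset b → Subset v
NB B Y = select (λ p → nonempty? (Y ∩ blocksThrough B p))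

module Submission where

-- For a point set X write xⱼ = |X ∩ B j|. Everything rests on two moments,
-- Σⱼ xⱼ = r|X| and Σⱼ xⱼ² = λ|X|(|X| − 1) + r|X|, both instances of the
-- identity IIᵀ = λJ + (r − λ)Id for the incidence matrix I; and xⱼ = 0 off N(X).
--   1. Σ (xⱼ − m)(xⱼ − m − 1) ≥ 0 over N(X), tight when every xⱼ ∈ {m, m+1}.
--   2. Cauchy–Schwarz: (Σ xⱼ)² ≤ |N(X)| Σ xⱼ².
--   3. Bound 2 for the points W outside N(Y), whose neighbourhood avoids Y,
--      combined with bk = vr and r(k − 1) = λ(v − 1).
--   4. For W′ = P ∖ (X ∪ N(Y)) and yⱼ = |W′ ∩ B j|: Σ xⱼyⱼ = λ|X||W′|, while
--      4xⱼyⱼ ≤ (xⱼ + yⱼ)² ≤ k² on N(X) ∖ Y and xⱼyⱼ = 0 elsewhere.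

open import Defs
open import Data.Nat using (ℕ)
open import Relation.Binary.PropositionalEquality using (_≡_)
open import Data.Fin using (Fin)
open import Data.Fin.Subset using (Subset; ∣_∣)

module Elementary where

  open import Data.Nat using (zero; suc; _+_; _*_; _≤_)
  open import Data.Nat.Properties using (≤-total; m≤n⇒∃[o]m+o≡n; m≤m+n; +-monoˡ-≤)
  open import Data.Product using (_,_)
  open import Data.Sum using (_⊎_; inj₁; inj₂)
  open import Relation.Binary.PropositionalEquality using (_≡_; refl; subst; subst₂)
  open import Data.Nat.Solver using (module +-*-Solver)
  open +-*-Solver

  ≤-witness : ∀ {a b} d → a + d ≡ b → a ≤ b
  ≤-witness {a} d a+d≡b = subst (a ≤_) a+d≡b (m≤m+n a d)

  -- AM–GM: 2ab ≤ a² + b², since the difference is the square of |a − b|.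
  am-gm : ∀ a b → 2 * (a * b) ≤ a * a + b * b
  am-gm a b with ≤-total a b
  ... | inj₁ a≤b with m≤n⇒∃[o]m+o≡n a≤b
  ...   | d , refl = ≤-witness (d * d)
          (solve 2 (λ a d → con 2 :* (a :* (a :+ d)) :+ d :* d := a :* a :+ (a :+ d) :* (a :+ d)) refl a d)
  am-gm a b | inj₂ b≤a with m≤n⇒∃[o]m+o≡n b≤a
  ...   | d , refl = ≤-witness (d * d)
          (solve 2 (λ b d → con 2 :* ((b :+ d) :* b) :+ d :* d := (b :+ d) :* (b :+ d) :+ b :* b) refl b d)

  -- (x − m)(x − m − 1) ≥ 0 for every natural x, i.e. (2m+1)x ≤ x² + m(m+1):
  -- a product of two consecutive integers is never negative.
  consecutive-product : ∀ m x → (2 * m + 1) * x ≤ x * x + m * (m + 1)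
  consecutive-product m x with ≤-total x m
  ... | inj₁ x≤m with m≤n⇒∃[o]m+o≡n x≤m
  ...   | d , refl = ≤-witness (d * d + d)
          (solve 2 (λ x d → (con 2 :* (x :+ d) :+ con 1) :* x :+ (d :* d :+ d)
                          := x :* x :+ (x :+ d) :* ((x :+ d) :+ con 1)) refl x d)
  consecutive-product m x | inj₂ m≤x with m≤n⇒∃[o]m+o≡n m≤x
  ...   | zero , refl = ≤-witness 0
          (solve 1 (λ m → (con 2 :* m :+ con 1) :* (m :+ con 0) :+ con 0
                        := (m :+ con 0) :* (m :+ con 0) :+ m :* (m :+ con 1)) refl m)
  ...   | suc d , refl = ≤-witness (d * d + d)
          (solve 2 (λ m d → (con 2 :* m :+ con 1) :* (m :+ (con 1 :+ d)) :+ (d :* d :+ d)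
                          := (m :+ (con 1 :+ d)) :* (m :+ (con 1 :+ d)) :+ m :* (m :+ con 1)) refl m d)

  consecutive-product-roots : ∀ m x → x ≡ m ⊎ x ≡ suc m → (2 * m + 1) * x ≡ x * x + m * (m + 1)
  consecutive-product-roots m x (inj₁ refl) =
    solve 1 (λ m → (con 2 :* m :+ con 1) :* m := m :* m :+ m :* (m :+ con 1)) refl m
  consecutive-product-roots m x (inj₂ refl) =
    solve 1 (λ m → (con 2 :* m :+ con 1) :* (con 1 :+ m) := (con 1 :+ m) :* (con 1 :+ m) :+ m :* (m :+ con 1)) refl m

  four-ab : ∀ a b → 4 * (a * b) ≤ (a + b) * (a + b)
  four-ab a b = subst₂ _≤_
    (solve 2 (λ a b → con 2 :* (a :* b) :+ con 2 :* (a :* b) := con 4 :* (a :* b)) refl a b)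
    (solve 2 (λ a b → a :* a :+ b :* b :+ con 2 :* (a :* b) := (a :+ b) :* (a :+ b)) refl a b)
    (+-monoˡ-≤ (2 * (a * b)) (am-gm a b))

module Sums where

  open import Data.Nat using (ℕ; zero; suc; _+_; _*_; _≤_; z≤n)
  open import Data.Nat.Properties
    using (+-*-semiring; +-mono-≤; *-cancelˡ-≤; +-identityʳ; *-assoc; module ≤-Reasoning)
  open import Data.Fin using (Fin; zero; suc; _≟_)
  open import Data.Bool using (if_then_else_)
  open import Relation.Nullary using (does)
  open import Relation.Nullary.Decidable using (dec-true; dec-false)
  open import Relation.Binary.PropositionalEquality using (_≡_; _≢_; refl; sym; trans; cong; cong₂; module ≡-Reasoning)
  open import Data.Nat.Solver using (module +-*-Solver)
  open +-*-Solver
  open import Algebra.Properties.Semiring.Sum +-*-semiring public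
    using (sum; sum-syntax; sum-cong-≗; ∑-distrib-+; ∑-comm; *-distribˡ-sum; *-distribʳ-sum; sum-replicate-zero)
  open Elementary using (am-gm)

  sum-mono : ∀ {n} {f g : Fin n → ℕ} → (∀ i → f i ≤ g i) → sum f ≤ sum g
  sum-mono {zero} f≤g = z≤n
  sum-mono {suc n} f≤g = +-mono-≤ (f≤g zero) (sum-mono (λ i → f≤g (suc i)))

  sum-const : ∀ n c → ∑[ i < n ] c ≡ n * c
  sum-const zero c = refl
  sum-const (suc n) c = cong (c +_) (sum-const n c)

  sum-product : ∀ {m n} (f : Fin m → ℕ) (g : Fin n → ℕ) →
                sum f * sum g ≡ ∑[ i < m ] ∑[ j < n ] (f i * g j)
  sum-product f g = trans (*-distribʳ-sum (sum g) f) (sum-cong-≗ (λ i → *-distribˡ-sum (f i) g))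

  sum-linear : ∀ {n} a c (x y : Fin n → ℕ) → ∑[ i < n ] (a * x i + c * y i) ≡ a * sum x + c * sum y
  sum-linear a c x y = trans (∑-distrib-+ (λ i → a * x i) (λ i → c * y i))
                             (sym (cong₂ _+_ (*-distribˡ-sum a x) (*-distribˡ-sum c y)))

  sum-adjoint : ∀ {m n} (M : Fin m → Fin n → ℕ) (x : Fin m → ℕ) (y : Fin n → ℕ) →
    ∑[ j < n ] ((∑[ i < m ] (x i * M i j)) * y j) ≡ ∑[ i < m ] (x i * ∑[ j < n ] (M i j * y j))
  sum-adjoint {m} {n} M x y = begin
    ∑[ j < n ] ((∑[ i < m ] (x i * M i j)) * y j)
      ≡⟨ sum-cong-≗ (λ j → *-distribʳ-sum (y j) (λ i → x i * M i j)) ⟩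
    ∑[ j < n ] ∑[ i < m ] (x i * M i j * y j)
      ≡⟨ ∑-comm (λ i j → x i * M i j * y j) ⟨
    ∑[ i < m ] ∑[ j < n ] (x i * M i j * y j)
      ≡⟨ sum-cong-≗ (λ i → sum-cong-≗ (λ j → *-assoc (x i) (M i j) (y j))) ⟩
    ∑[ i < m ] ∑[ j < n ] (x i * (M i j * y j))
      ≡⟨ sum-cong-≗ (λ i → *-distribˡ-sum (x i) (λ j → M i j * y j)) ⟨
    ∑[ i < m ] (x i * ∑[ j < n ] (M i j * y j)) ∎
    where open ≡-Reasoning

  δ : ∀ {n} → Fin n → Fin n → ℕ
  δ p q = if does (p ≟ q) then 1 else 0

  δ-diag : ∀ {n} (p : Fin n) → δ p p ≡ 1
  δ-diag p = cong (λ d → if d then 1 else 0) (dec-true (p ≟ p) refl)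

  δ-off : ∀ {n} {p q : Fin n} → p ≢ q → δ p q ≡ 0
  δ-off {p = p} {q} p≢q = cong (λ d → if d then 1 else 0) (dec-false (p ≟ q) p≢q)

  sum-δ : ∀ {n} (p : Fin n) (g : Fin n → ℕ) → ∑[ q < n ] (δ p q * g q) ≡ g p
  sum-δ {suc n} zero g = trans (cong₂ _+_ (+-identityʳ (g zero)) (sum-replicate-zero n)) (+-identityʳ (g zero))
  sum-δ {suc n} (suc p) g = sum-δ p (λ q → g (suc q))

  -- Cauchy–Schwarz for natural-number vectors: (Σ fᵢgᵢ)² ≤ (Σ fᵢ²)(Σ gᵢ²).
  -- Doubling both sides, it is the sum over all (i, j) of the AM–GM bound
  -- 2 (fᵢ gⱼ)(fⱼ gᵢ) ≤ (fᵢ gⱼ)² + (fⱼ gᵢ)².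
  cauchy-schwarz : ∀ {n} (f g : Fin n → ℕ) →
    (∑[ i < n ] (f i * g i)) * (∑[ i < n ] (f i * g i)) ≤ (∑[ i < n ] (f i * f i)) * (∑[ i < n ] (g i * g i))
  cauchy-schwarz {n} f g = *-cancelˡ-≤ 2 (begin
      2 * (sum fg * sum fg)
        ≡⟨ cong (2 *_) (sum-product fg fg) ⟩
      2 * (∑[ i < n ] ∑[ j < n ] (fg i * fg j))
        ≡⟨ doubled (λ i j → fg i * fg j) ⟩
      ∑[ i < n ] ∑[ j < n ] (2 * (fg i * fg j))
        ≤⟨ sum-mono (λ i → sum-mono (λ j → pointwise i j)) ⟩
      ∑[ i < n ] ∑[ j < n ] (P i j + P j i)
        ≡⟨ sum-cong-≗ (λ i → ∑-distrib-+ (P i) (λ j → P j i)) ⟩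
      ∑[ i < n ] (∑[ j < n ] P i j + ∑[ j < n ] P j i)
        ≡⟨ ∑-distrib-+ (λ i → ∑[ j < n ] P i j) (λ i → ∑[ j < n ] P j i) ⟩
      (∑[ i < n ] ∑[ j < n ] P i j) + (∑[ i < n ] ∑[ j < n ] P j i)
        ≡⟨ cong (∑[ i < n ] ∑[ j < n ] P i j +_) (∑-comm (λ i j → P j i)) ⟩
      (∑[ i < n ] ∑[ j < n ] P i j) + (∑[ i < n ] ∑[ j < n ] P i j)
        ≡⟨ solve 1 (λ x → x :+ x := con 2 :* x) refl (∑[ i < n ] ∑[ j < n ] P i j) ⟩
      2 * (∑[ i < n ] ∑[ j < n ] P i j)
        ≡⟨ cong (2 *_) (sym (sum-product ff gg)) ⟩
      2 * (sum ff * sum gg) ∎)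
    where
    open ≤-Reasoning
    fg ff gg : Fin n → ℕ
    fg i = f i * g i
    ff i = f i * f i
    gg i = g i * g i
    P : Fin n → Fin n → ℕ
    P i j = ff i * gg j
    doubled : (h : Fin n → Fin n → ℕ) → 2 * (∑[ i < n ] ∑[ j < n ] h i j) ≡ ∑[ i < n ] ∑[ j < n ] (2 * h i j)
    doubled h = trans (*-distribˡ-sum 2 (λ i → ∑[ j < n ] h i j)) (sum-cong-≗ (λ i → *-distribˡ-sum 2 (h i)))
    pointwise : ∀ i j → 2 * (fg i * fg j) ≤ P i j + P j i
    pointwise i j = begin
      2 * (fg i * fg j)
        ≡⟨ solve 4 (λ a b c d → con 2 :* ((a :* b) :* (c :* d)) := con 2 :* ((a :* d) :* (c :* b))) refl (f i) (g i) (f j) (g j) ⟩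
      2 * ((f i * g j) * (f j * g i))
        ≤⟨ am-gm (f i * g j) (f j * g i) ⟩
      (f i * g j) * (f i * g j) + (f j * g i) * (f j * g i)
        ≡⟨ solve 4 (λ a b c d → (a :* d) :* (a :* d) :+ (c :* b) :* (c :* b)
                               := (a :* a) :* (d :* d) :+ (c :* c) :* (b :* b)) refl (f i) (g i) (f j) (g j) ⟩
      P i j + P j i ∎

module Indicators where

  open import Data.Nat using (ℕ; zero; suc; _+_; _*_; _≤_; z≤n; s≤s)
  open import Data.Nat.Properties using (+-identityʳ; ≤-reflexive; m+[n∸m]≡n)
  open import Data.Bool using (Bool; true; false; _∧_; if_then_else_)
  open import Data.Fin using (Fin; zero; suc)
  open import Data.Fin.Subset using (Subset; inside; outside; _∈_; _∉_; _∩_; _─_; ∣_∣; ∁; Nonempty)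
  open import Data.Fin.Subset.Properties using (_∈?_; Empty-unique; ∣⊥∣≡0; ∣∁p∣≡n∸∣p∣; ∣p∣≤n)
  open import Data.Vec using (_∷_; []; lookup; here; there)
  open import Data.Vec.Properties using (lookup∘tabulate; []=⇒lookup; lookup⇒[]=)
  open import Relation.Nullary using (Dec; yes; no; does; ¬_)
  open import Relation.Nullary.Negation using (contradiction)
  open import Relation.Nullary.Decidable using (dec-true)
  open import Relation.Binary.PropositionalEquality using (_≡_; refl; sym; trans; cong; cong₂; subst)
  open import Function using (_∘_)
  open Sums using (sum)

  bit : Bool → ℕ
  bit true = 1
  bit false = 0

  bit-∧ : ∀ a c → bit (a ∧ c) ≡ bit a * bit c
  bit-∧ true c = sym (+-identityʳ (bit c))
  bit-∧ false c = refl

  bit-idem : ∀ a → bit a * bit a ≡ bit a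
  bit-idem true = refl
  bit-idem false = refl

  bit≤1 : ∀ a → bit a ≤ 1
  bit≤1 true = s≤s z≤n
  bit≤1 false = z≤n

  χ : ∀ {n} → Subset n → Fin n → ℕ
  χ S i = bit (lookup S i)

  card-sum : ∀ {n} (S : Subset n) → ∣ S ∣ ≡ sum (χ S)
  card-sum [] = refl
  card-sum (true ∷ S) = cong suc (card-sum S)
  card-sum (false ∷ S) = card-sum S

  χ-∩ : ∀ {n} (S T : Subset n) i → χ (S ∩ T) i ≡ χ S i * χ T i
  χ-∩ (a ∷ S) (c ∷ T) zero = bit-∧ a c
  χ-∩ (a ∷ S) (c ∷ T) (suc i) = χ-∩ S T i

  card-∩ : ∀ {n} (S T : Subset n) → ∣ S ∩ T ∣ ≡ sum (λ i → χ S i * χ T i)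
  card-∩ S T = trans (card-sum (S ∩ T)) (Sums.sum-cong-≗ (χ-∩ S T))

  χ-idem : ∀ {n} (S : Subset n) i → χ S i * χ S i ≡ χ S i
  χ-idem S i = bit-idem (lookup S i)

  χ≤1 : ∀ {n} (S : Subset n) i → χ S i ≤ 1
  χ≤1 S i = bit≤1 (lookup S i)

  χ-∈ : ∀ {n} {S : Subset n} {i} → i ∈ S → χ S i ≡ 1
  χ-∈ i∈S = cong bit ([]=⇒lookup i∈S)

  χ-∉ : ∀ {n} {S : Subset n} {i} → i ∉ S → χ S i ≡ 0
  χ-∉ {S = S} {i} i∉S with lookup S i in eq
  ... | true = contradiction (lookup⇒[]= i S eq) i∉S
  ... | false = refl

  empty-card : ∀ {n} {S : Subset n} → ¬ Nonempty S → ∣ S ∣ ≡ 0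
  empty-card {n} ¬ne = trans (cong ∣_∣ (Empty-unique ¬ne)) (∣⊥∣≡0 n)

  card-complement : ∀ {n} (S : Subset n) → ∣ S ∣ + ∣ ∁ S ∣ ≡ n
  card-complement S = trans (cong (∣ S ∣ +_) (∣∁p∣≡n∸∣p∣ S)) (m+[n∸m]≡n (∣p∣≤n S))

  does-∈? : ∀ {n} (i : Fin n) (S : Subset n) → does (i ∈? S) ≡ lookup S i
  does-∈? zero (true ∷ S) = refl
  does-∈? zero (false ∷ S) = refl
  does-∈? (suc i) (a ∷ S) = does-∈? i S

  χ-select : ∀ {n} {P : Fin n → Set} (P? : ∀ i → Dec (P i)) i → χ (select P?) i ≡ bit (does (P? i))
  χ-select P? i = trans (cong bit (lookup∘tabulate _ i)) (bit-if (does (P? i)))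
    where
    bit-if : ∀ a → bit (if a then inside else outside) ≡ bit a
    bit-if true = refl
    bit-if false = refl

  ∈-select⁺ : ∀ {n} {P : Fin n → Set} (P? : ∀ i → Dec (P i)) {i} → P i → i ∈ select P?
  ∈-select⁺ P? {i} Pi = lookup⇒[]= i (select P?)
    (trans (lookup∘tabulate _ i) (cong (λ a → if a then inside else outside) (dec-true (P? i) Pi)))

  ∈-select⁻ : ∀ {n} {P : Fin n → Set} (P? : ∀ i → Dec (P i)) {i} → i ∈ select P? → P i
  ∈-select⁻ P? {i} i∈S with P? i | lookup∘tabulate (λ i → if does (P? i) then inside else outside) i
  ... | yes Pi | _ = Pi
  ... | no _ | eq = contradiction (trans (sym eq) ([]=⇒lookup i∈S)) λ ()

  ∉-select : ∀ {n} {P : Fin n → Set} (P? : ∀ i → Dec (P i)) {i} → ¬ P i → i ∉ select P?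
  ∉-select P? ¬Pi = ¬Pi ∘ ∈-select⁻ P?

  χ-disjoint : ∀ {n} {S T : Subset n} → (∀ {i} → i ∈ S → i ∉ T) → ∀ i → χ S i + χ T i ≤ 1
  χ-disjoint {S = S} {T} disjoint i with i ∈? S
  ... | yes i∈S = ≤-reflexive (cong₂ _+_ (χ-∈ i∈S) (χ-∉ (disjoint i∈S)))
  ... | no i∉S = subst (_≤ 1) (cong (_+ χ T i) (sym (χ-∉ i∉S))) (χ≤1 T i)

  ∈-─⁺ : ∀ {n} {i : Fin n} (S T : Subset n) → i ∈ S → i ∉ T → i ∈ S ─ T
  ∈-─⁺ (true ∷ S) (false ∷ T) here i∉T = here
  ∈-─⁺ (true ∷ S) (true ∷ T) here i∉T = contradiction here i∉T
  ∈-─⁺ (a ∷ S) (c ∷ T) (there i∈S) i∉T = there (∈-─⁺ S T i∈S (i∉T ∘ there))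

module Incidence {v b : ℕ} (B : Fin b → Subset v) where

  open import Data.Nat using (ℕ; _+_; _*_; _≤_)
  open import Data.Nat.Properties using (*-comm; *-distribʳ-+; *-monoˡ-≤; *-identityˡ; module ≤-Reasoning)
  open import Data.Fin using (Fin)
  open import Data.Fin.Subset using (Subset; _∈_; _∉_; _∩_; ∣_∣; Nonempty)
  open import Data.Fin.Subset.Properties using (_∈?_; nonempty?; x∈p∩q⁺; x∈p∩q⁻)
  open import Data.Product using (_×_; _,_)
  open import Data.Sum using (_⊎_; inj₁; inj₂)
  open import Data.Bool using (_∧_)
  open import Relation.Nullary using (Dec; yes; no; does; ¬_)
  open import Relation.Nullary.Decidable using (_×-dec_)
  open import Relation.Binary.PropositionalEquality using (_≡_; refl; sym; trans; cong; cong₂; module ≡-Reasoning)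
  open import Data.Nat.Solver using (module +-*-Solver)
  open +-*-Solver
  open Sums
  open Indicators

  I : Fin v → Fin b → ℕ
  I p j = χ (B j) p

  degree-sum : ∀ p → ∣ blocksThrough B p ∣ ≡ ∑[ j < b ] I p j
  degree-sum p = trans (card-sum (blocksThrough B p))
    (sum-cong-≗ (λ j → trans (χ-select (λ j → p ∈? B j) j) (cong bit (does-∈? p (B j)))))

  coincidence-sum : ∀ p q →
    ∣ select (λ j → (p ∈? B j) ×-dec (q ∈? B j)) ∣ ≡ ∑[ j < b ] (I p j * I q j)
  coincidence-sum p q = trans (card-sum (select both?)) (sum-cong-≗ entry)
    where
    open ≡-Reasoning
    both? : ∀ j → Dec (p ∈ B j × q ∈ B j)
    both? j = (p ∈? B j) ×-dec (q ∈? B j)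
    entry : ∀ j → χ (select both?) j ≡ I p j * I q j
    entry j = begin
      χ (select both?) j                               ≡⟨ χ-select both? j ⟩
      bit (does (p ∈? B j) ∧ does (q ∈? B j))          ≡⟨ bit-∧ (does (p ∈? B j)) (does (q ∈? B j)) ⟩
      bit (does (p ∈? B j)) * bit (does (q ∈? B j))
        ≡⟨ cong₂ (λ a c → bit a * bit c) (does-∈? p (B j)) (does-∈? q (B j)) ⟩
      I p j * I q j                                    ∎

  G : Fin v → Fin v → ℕ
  G p q = ∑[ j < b ] (I p j * I q j)

  profile : (Fin v → ℕ) → Fin b → ℕ
  profile f j = ∑[ p < v ] (f p * I p j)

  profile-χ : ∀ S j → profile (χ S) j ≡ ∣ S ∩ B j ∣
  profile-χ S j = sym (card-∩ S (B j))

  profile-total : ∀ {r} → (∀ p → ∑[ j < b ] I p j ≡ r) → ∀ f → sum (profile f) ≡ sum f * r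
  profile-total {r} row f = begin
    ∑[ j < b ] ∑[ p < v ] (f p * I p j)
      ≡⟨ ∑-comm (λ p j → f p * I p j) ⟨
    ∑[ p < v ] ∑[ j < b ] (f p * I p j)
      ≡⟨ sum-cong-≗ (λ p → trans (sym (*-distribˡ-sum (f p) (I p))) (cong (f p *_) (row p))) ⟩
    ∑[ p < v ] (f p * r)
      ≡⟨ *-distribʳ-sum r f ⟨
    sum f * r ∎
    where open ≡-Reasoning

  profile-inner : ∀ f g →
    ∑[ j < b ] (profile f j * profile g j) ≡ ∑[ p < v ] (f p * ∑[ q < v ] (G p q * g q))
  profile-inner f g = trans (sum-adjoint I f (profile g)) (sum-cong-≗ (λ p → cong (f p *_) (row p)))
    where
    open ≡-Reasoning
    row : ∀ p → ∑[ j < b ] (I p j * profile g j) ≡ ∑[ q < v ] (G p q * g q)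
    row p = begin
      ∑[ j < b ] (I p j * profile g j)
        ≡⟨ sum-cong-≗ (λ j → *-comm (I p j) (profile g j)) ⟩
      ∑[ j < b ] (profile g j * I p j)
        ≡⟨ sum-adjoint I g (I p) ⟩
      ∑[ q < v ] (g q * ∑[ j < b ] (I q j * I p j))
        ≡⟨ sum-cong-≗ (λ q → trans (*-comm (g q) _) (cong (_* g q) (sum-cong-≗ (λ j → *-comm (I q j) (I p j))))) ⟩
      ∑[ q < v ] (G p q * g q) ∎

  -- If the Gram matrix is G = λJ + (r − λ)Id, written G + λ Id = λJ + r Id to
  -- stay in ℕ, then (Gg)ₚ + λ gₚ = λ Σ g + r gₚ for every weighting g.
  gram-row : ∀ lam r → (∀ p q → G p q + lam * δ p q ≡ lam + r * δ p q) →
    ∀ g p → ∑[ q < v ] (G p q * g q) + lam * g p ≡ lam * sum g + r * g p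
  gram-row lam r gram g p = begin
    ∑[ q < v ] (G p q * g q) + lam * g p
      ≡⟨ cong (λ t → ∑[ q < v ] (G p q * g q) + lam * t) (sum-δ p g) ⟨
    ∑[ q < v ] (G p q * g q) + lam * ∑[ q < v ] (δ p q * g q)
      ≡⟨ cong (∑[ q < v ] (G p q * g q) +_) (*-distribˡ-sum lam (λ q → δ p q * g q)) ⟩
    ∑[ q < v ] (G p q * g q) + ∑[ q < v ] (lam * (δ p q * g q))
      ≡⟨ ∑-distrib-+ (λ q → G p q * g q) (λ q → lam * (δ p q * g q)) ⟨
    ∑[ q < v ] (G p q * g q + lam * (δ p q * g q))
      ≡⟨ sum-cong-≗ entry ⟩
    ∑[ q < v ] (lam * g q + r * (δ p q * g q))
      ≡⟨ sum-linear lam r g (λ q → δ p q * g q) ⟩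
    lam * sum g + r * ∑[ q < v ] (δ p q * g q)
      ≡⟨ cong (λ t → lam * sum g + r * t) (sum-δ p g) ⟩
    lam * sum g + r * g p ∎
    where
    open ≡-Reasoning
    entry : ∀ q → G p q * g q + lam * (δ p q * g q) ≡ lam * g q + r * (δ p q * g q)
    entry q = begin
      G p q * g q + lam * (δ p q * g q)
        ≡⟨ solve 4 (λ c z l d → c :* z :+ l :* (d :* z) := (c :+ l :* d) :* z) refl (G p q) (g q) lam (δ p q) ⟩
      (G p q + lam * δ p q) * g q
        ≡⟨ cong (_* g q) (gram p q) ⟩
      (lam + r * δ p q) * g q
        ≡⟨ solve 4 (λ l r d z → (l :+ r :* d) :* z := l :* z :+ r :* (d :* z)) refl lam r (δ p q) (g q) ⟩
      lam * g q + r * (δ p q * g q) ∎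

  quadratic-form : ∀ lam r → (∀ p q → G p q + lam * δ p q ≡ lam + r * δ p q) →
    ∀ f g → ∑[ j < b ] (profile f j * profile g j) + lam * ∑[ p < v ] (f p * g p)
          ≡ lam * (sum f * sum g) + r * ∑[ p < v ] (f p * g p)
  quadratic-form lam r gram f g = begin
    ∑[ j < b ] (profile f j * profile g j) + lam * ∑[ p < v ] (f p * g p)
      ≡⟨ cong₂ _+_ (profile-inner f g) (*-distribˡ-sum lam (λ p → f p * g p)) ⟩
    ∑[ p < v ] (f p * Gg p) + ∑[ p < v ] (lam * (f p * g p))
      ≡⟨ ∑-distrib-+ (λ p → f p * Gg p) (λ p → lam * (f p * g p)) ⟨
    ∑[ p < v ] (f p * Gg p + lam * (f p * g p))
      ≡⟨ sum-cong-≗ entry ⟩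
    ∑[ p < v ] (lam * (f p * sum g) + r * (f p * g p))
      ≡⟨ sum-linear lam r (λ p → f p * sum g) (λ p → f p * g p) ⟩
    lam * ∑[ p < v ] (f p * sum g) + r * ∑[ p < v ] (f p * g p)
      ≡⟨ cong (λ t → lam * t + r * ∑[ p < v ] (f p * g p)) (*-distribʳ-sum (sum g) f) ⟨
    lam * (sum f * sum g) + r * ∑[ p < v ] (f p * g p) ∎
    where
    open ≡-Reasoning
    Gg : Fin v → ℕ
    Gg p = ∑[ q < v ] (G p q * g q)
    entry : ∀ p → f p * Gg p + lam * (f p * g p) ≡ lam * (f p * sum g) + r * (f p * g p)
    entry p = begin
      f p * Gg p + lam * (f p * g p)
        ≡⟨ solve 4 (λ x y l z → x :* y :+ l :* (x :* z) := x :* (y :+ l :* z)) refl (f p) (Gg p) lam (g p) ⟩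
      f p * (Gg p + lam * g p)
        ≡⟨ cong (f p *_) (gram-row lam r gram g p) ⟩
      f p * (lam * sum g + r * g p)
        ≡⟨ solve 5 (λ x l s r z → x :* (l :* s :+ r :* z) := l :* (x :* s) :+ r :* (x :* z)) refl (f p) lam (sum g) r (g p) ⟩
      lam * (f p * sum g) + r * (f p * g p) ∎

  meets-or-misses : ∀ X j → j ∈ NP B X ⊎ (j ∉ NP B X × ∣ X ∩ B j ∣ ≡ 0)
  meets-or-misses X j with nonempty? (X ∩ B j)
  ... | yes X∩Bj≠∅ = inj₁ (∈-select⁺ (λ j → nonempty? (X ∩ B j)) X∩Bj≠∅)
  ... | no X∩Bj=∅ = inj₂ (∉-select (λ j → nonempty? (X ∩ B j)) X∩Bj=∅ , empty-card X∩Bj=∅)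

  NB-closed : ∀ {Y j p} → j ∈ Y → p ∈ B j → p ∈ NB B Y
  NB-closed {Y} {j} {p} j∈Y p∈Bj = ∈-select⁺ (λ p → nonempty? (Y ∩ blocksThrough B p))
    (j , x∈p∩q⁺ (j∈Y , ∈-select⁺ (λ j → p ∈? B j) p∈Bj))

  avoids-blocks : ∀ {Y S j} → (∀ {p} → p ∈ S → p ∉ NB B Y) → j ∈ Y → ¬ Nonempty (S ∩ B j)
  avoids-blocks {S = S} {j} avoid j∈Y (p , p∈S∩Bj) with x∈p∩q⁻ S (B j) p∈S∩Bj
  ... | p∈S , p∈Bj = avoid p∈S (NB-closed j∈Y p∈Bj)

  disjoint-in-block : ∀ {S T} → (∀ {p} → p ∈ S → p ∉ T) → ∀ j → ∣ S ∩ B j ∣ + ∣ T ∩ B j ∣ ≤ ∣ B j ∣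
  disjoint-in-block {S} {T} disjoint j = begin
    ∣ S ∩ B j ∣ + ∣ T ∩ B j ∣
      ≡⟨ cong₂ _+_ (profile-χ S j) (profile-χ T j) ⟨
    profile (χ S) j + profile (χ T) j
      ≡⟨ ∑-distrib-+ (λ p → χ S p * I p j) (λ p → χ T p * I p j) ⟨
    ∑[ p < v ] (χ S p * I p j + χ T p * I p j)
      ≡⟨ sum-cong-≗ (λ p → *-distribʳ-+ (I p j) (χ S p) (χ T p)) ⟨
    ∑[ p < v ] ((χ S p + χ T p) * I p j)
      ≤⟨ sum-mono (λ p → *-monoˡ-≤ (I p j) (χ-disjoint disjoint p)) ⟩
    ∑[ p < v ] (1 * I p j)
      ≡⟨ sum-cong-≗ (λ p → *-identityˡ (I p j)) ⟩
    ∑[ p < v ] I p j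
      ≡⟨ card-sum (B j) ⟨
    ∣ B j ∣ ∎
    where open ≤-Reasoning

module Arithmetic where

  open import Data.Nat using (zero; suc; _+_; _*_; _≤_)
  open import Data.Nat.Properties
    using (*-monoʳ-≤; *-cancelˡ-≤; +-monoˡ-≤; +-mono-≤; m≤n⇒∃[o]m+o≡n; module ≤-Reasoning)
  open import Data.Product using (_,_)
  open import Relation.Binary.PropositionalEquality using (_≡_; refl; cong)
  open import Data.Nat.Solver using (module +-*-Solver)
  open +-*-Solver

  -- From (sr)² ≤ Q·N and Q + λs = λs² + rs, dividing by s:
  -- r²s + Nλ ≤ N(r + λs). For s = 0 this is Nλ ≤ Nr.
  divide-by-size : ∀ {lam r s N Q} → lam ≤ r → s * r * (s * r) ≤ Q * N →
                   Q + lam * s ≡ lam * (s * s) + r * s → r * r * s + N * lam ≤ N * (r + lam * s)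
  divide-by-size {lam} {r} {zero} {N} λ≤r _ _ = begin
    r * r * 0 + N * lam   ≡⟨ solve 3 (λ r N l → r :* r :* con 0 :+ N :* l := N :* l) refl r N lam ⟩
    N * lam               ≤⟨ *-monoʳ-≤ N λ≤r ⟩
    N * r                 ≡⟨ solve 3 (λ r N l → N :* r := N :* (r :+ l :* con 0)) refl r N lam ⟩
    N * (r + lam * 0)     ∎
    where open ≤-Reasoning
  divide-by-size {lam} {r} {s@(suc _)} {N} {Q} _ cs second = *-cancelˡ-≤ s (begin
    s * (r * r * s + N * lam)
      ≡⟨ solve 4 (λ s r N l → s :* (r :* r :* s :+ N :* l) := s :* r :* (s :* r) :+ N :* (l :* s)) refl s r N lam ⟩
    s * r * (s * r) + N * (lam * s)
      ≤⟨ +-monoˡ-≤ (N * (lam * s)) cs ⟩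
    Q * N + N * (lam * s)
      ≡⟨ solve 3 (λ N Q t → Q :* N :+ N :* t := N :* (Q :+ t)) refl N Q (lam * s) ⟩
    N * (Q + lam * s)
      ≡⟨ cong (N *_) second ⟩
    N * (lam * (s * s) + r * s)
      ≡⟨ solve 4 (λ s r N l → N :* (l :* (s :* s) :+ r :* s) := s :* (N :* (r :+ l :* s))) refl s r N lam ⟩
    s * (N * (r + lam * s)) ∎)
    where open ≤-Reasoning

  enlarge : ∀ {a N c lam t} → a + N * lam ≤ N * t → N ≤ c → lam ≤ t → a + c * lam ≤ c * t
  enlarge {a} {N} {c} {lam} {t} h N≤c λ≤t with m≤n⇒∃[o]m+o≡n N≤c
  ... | d , refl = begin
    a + (N + d) * lam
      ≡⟨ solve 4 (λ a N d l → a :+ (N :+ d) :* l := (a :+ N :* l) :+ d :* l) refl a N d lam ⟩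
    a + N * lam + d * lam
      ≤⟨ +-mono-≤ h (*-monoʳ-≤ d λ≤t) ⟩
    N * t + d * t
      ≡⟨ solve 3 (λ N d t → N :* t :+ d :* t := (N :+ d) :* t) refl N d t ⟩
    (N + d) * t ∎
    where open ≤-Reasoning

module Design {v k lam b r : ℕ} {B : Fin b → Subset v}
              (D : IsDesign v k lam b B) (R : ∀ p → ∣ blocksThrough B p ∣ ≡ r) where

  open import Data.Nat using (suc; _+_; _*_; _≤_; s≤s; z≤n)
  open import Data.Nat.Properties
    using (<-trans; ≤-trans; ≤-reflexive; m≤m+n; *-monoʳ-≤; *-mono-≤; +-identityʳ;
           *-identityʳ; *-identityˡ; *-comm; *-zeroʳ; module ≤-Reasoning)
  open import Data.Fin using (zero; suc; _≟_; fromℕ<)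
  open import Data.Fin.Subset using (_∈_; _∉_; _∩_; _∪_; _─_; _⊆_; ⊤; ⁅_⁆; ∁; Nonempty)
  open import Data.Fin.Subset.Properties
    using (_∈?_; nonempty?; ∩-idem; ∩-identityˡ; ∩-identityʳ; ∣⊤∣≡n; ∣⁅x⁆∣≡1; p⊆q⇒∣p∣≤∣q∣;
           x∈p∩q⁻; x∈p∪q⁺; x∈∁p⇒x∉p; x∉p⇒x∈∁p)
  open import Data.Product using (_,_; ∃₂)
  open import Data.Sum using (_⊎_; inj₁; inj₂)
  open import Relation.Nullary using (Dec; yes; no; ¬_)
  open import Relation.Binary.PropositionalEquality
    using (_≡_; _≢_; refl; sym; trans; cong; cong₂; subst; subst₂; module ≡-Reasoning)
  open import Data.Nat.Solver using (module +-*-Solver)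
  open +-*-Solver
  open Elementary using (consecutive-product; consecutive-product-roots; four-ab)
  open Arithmetic using (divide-by-size; enlarge)
  open IsDesign D
  open Sums
  open Indicators
  open Incidence B

  replication : ∀ p → ∑[ j < b ] I p j ≡ r
  replication p = trans (sym (degree-sum p)) (R p)

  G-diag : ∀ p → G p p ≡ r
  G-diag p = trans (sum-cong-≗ (λ j → χ-idem (B j) p)) (replication p)

  G-off : ∀ {p q} → p ≢ q → G p q ≡ lam
  G-off {p} {q} p≢q = trans (sym (coincidence-sum p q)) (pairs p q p≢q)

  gram : ∀ p q → G p q + lam * δ p q ≡ lam + r * δ p q
  gram p q = by-cases p q (p ≟ q)
    where
    by-cases : ∀ p q → Dec (p ≡ q) → G p q + lam * δ p q ≡ lam + r * δ p q
    by-cases p .p (yes refl) = begin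
      G p p + lam * δ p p   ≡⟨ cong₂ (λ x y → x + lam * y) (G-diag p) (δ-diag p) ⟩
      r + lam * 1           ≡⟨ solve 2 (λ r l → r :+ l :* con 1 := l :+ r :* con 1) refl r lam ⟩
      lam + r * 1           ≡⟨ cong (λ y → lam + r * y) (δ-diag p) ⟨
      lam + r * δ p p       ∎
      where open ≡-Reasoning
    by-cases p q (no p≢q) = begin
      G p q + lam * δ p q   ≡⟨ cong₂ (λ x y → x + lam * y) (G-off p≢q) (δ-off p≢q) ⟩
      lam + lam * 0         ≡⟨ solve 2 (λ r l → l :+ l :* con 0 := l :+ r :* con 0) refl r lam ⟩
      lam + r * 0           ≡⟨ cong (λ y → lam + r * y) (δ-off p≢q) ⟨
      lam + r * δ p q       ∎
      where open ≡-Reasoning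

  incidences : ∀ S → ∑[ j < b ] ∣ S ∩ B j ∣ ≡ ∣ S ∣ * r
  incidences S = begin
    ∑[ j < b ] ∣ S ∩ B j ∣   ≡⟨ sum-cong-≗ (profile-χ S) ⟨
    sum (profile (χ S))      ≡⟨ profile-total replication (χ S) ⟩
    sum (χ S) * r            ≡⟨ cong (_* r) (card-sum S) ⟨
    ∣ S ∣ * r                ∎
    where open ≡-Reasoning

  intersection-pairs : ∀ S T →
    ∑[ j < b ] (∣ S ∩ B j ∣ * ∣ T ∩ B j ∣) + lam * ∣ S ∩ T ∣ ≡ lam * (∣ S ∣ * ∣ T ∣) + r * ∣ S ∩ T ∣
  intersection-pairs S T = begin
    ∑[ j < b ] (∣ S ∩ B j ∣ * ∣ T ∩ B j ∣) + lam * ∣ S ∩ T ∣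
      ≡⟨ cong₂ (λ x y → x + lam * y) (sum-cong-≗ (λ j → cong₂ _*_ (profile-χ S j) (profile-χ T j))) (sym (card-∩ S T)) ⟨
    ∑[ j < b ] (profile (χ S) j * profile (χ T) j) + lam * ∑[ p < v ] (χ S p * χ T p)
      ≡⟨ quadratic-form lam r gram (χ S) (χ T) ⟩
    lam * (sum (χ S) * sum (χ T)) + r * ∑[ p < v ] (χ S p * χ T p)
      ≡⟨ cong₂ (λ x y → lam * x + r * y) (cong₂ _*_ (card-sum S) (card-sum T)) (card-∩ S T) ⟨
    lam * (∣ S ∣ * ∣ T ∣) + r * ∣ S ∩ T ∣ ∎
    where open ≡-Reasoning

  P : Subset v
  P = ⊤

  block-size : ∀ j → ∣ P ∩ B j ∣ ≡ k
  block-size j = trans (cong ∣_∣ (∩-identityˡ (B j))) (blockSize j)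

  bk≡vr : b * k ≡ v * r
  bk≡vr = begin
    b * k                    ≡⟨ sum-const b k ⟨
    ∑[ j < b ] k             ≡⟨ sum-cong-≗ block-size ⟨
    ∑[ j < b ] ∣ P ∩ B j ∣   ≡⟨ incidences P ⟩
    ∣ P ∣ * r                ≡⟨ cong (_* r) (∣⊤∣≡n v) ⟩
    v * r                    ∎
    where open ≡-Reasoning

  -- Counting the pairs through a fixed point p: r(k − 1) = λ(v − 1), i.e. the
  -- intersection-pair identity for S = {p} and T = P.
  rk+λ≡λv+r : r * k + lam ≡ lam * v + r
  rk+λ≡λv+r = begin
    r * k + lam
      ≡⟨ solve 3 (λ r k l → r :* k :+ l := con 1 :* r :* k :+ l :* con 1) refl r k lam ⟩
    1 * r * k + lam * 1
      ≡⟨ cong₂ (λ x y → x * r * k + lam * y) one one∩P ⟨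
    ∣ ⁅ p ⁆ ∣ * r * k + lam * ∣ ⁅ p ⁆ ∩ P ∣
      ≡⟨ cong (λ x → x * k + lam * ∣ ⁅ p ⁆ ∩ P ∣) (incidences ⁅ p ⁆) ⟨
    (∑[ j < b ] ∣ ⁅ p ⁆ ∩ B j ∣) * k + lam * ∣ ⁅ p ⁆ ∩ P ∣
      ≡⟨ cong (_+ lam * ∣ ⁅ p ⁆ ∩ P ∣) (trans (*-distribʳ-sum k (λ j → ∣ ⁅ p ⁆ ∩ B j ∣))
           (sum-cong-≗ (λ j → cong (∣ ⁅ p ⁆ ∩ B j ∣ *_) (sym (block-size j))))) ⟩
    ∑[ j < b ] (∣ ⁅ p ⁆ ∩ B j ∣ * ∣ P ∩ B j ∣) + lam * ∣ ⁅ p ⁆ ∩ P ∣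
      ≡⟨ intersection-pairs ⁅ p ⁆ P ⟩
    lam * (∣ ⁅ p ⁆ ∣ * ∣ P ∣) + r * ∣ ⁅ p ⁆ ∩ P ∣
      ≡⟨ cong₂ (λ x z → lam * (x * ∣ P ∣) + r * z) one one∩P ⟩
    lam * (1 * ∣ P ∣) + r * 1
      ≡⟨ cong (λ y → lam * (1 * y) + r * 1) (∣⊤∣≡n v) ⟩
    lam * (1 * v) + r * 1
      ≡⟨ solve 3 (λ l v r → l :* (con 1 :* v) :+ r :* con 1 := l :* v :+ r) refl lam v r ⟩
    lam * v + r ∎
    where
    open ≡-Reasoning
    p : Fin v
    p = fromℕ< (<-trans 0<λ (<-trans lam<k k<v))
    one : ∣ ⁅ p ⁆ ∣ ≡ 1
    one = ∣⁅x⁆∣≡1 p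
    one∩P : ∣ ⁅ p ⁆ ∩ P ∣ ≡ 1
    one∩P = trans (cong ∣_∣ (∩-identityʳ ⁅ p ⁆)) one

  distinct-points : ∀ {n} → 2 ≤ n → ∃₂ λ (p q : Fin n) → p ≢ q
  distinct-points (s≤s (s≤s _)) = zero , suc zero , λ ()

  -- Two distinct points lie together on at most as many blocks as either
  -- alone, so λ ≤ r.
  λ≤r : lam ≤ r
  λ≤r with distinct-points (≤-trans (s≤s 0<λ) (<-trans lam<k k<v))
  ... | p , q , p≢q = begin
    lam
      ≡⟨ G-off p≢q ⟨
    G p q
      ≤⟨ sum-mono (λ j → ≤-trans (*-monoʳ-≤ (I p j) (χ≤1 (B j) q)) (≤-reflexive (*-identityʳ (I p j)))) ⟩
    ∑[ j < b ] I p j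
      ≡⟨ replication p ⟩
    r ∎
    where open ≤-Reasoning

  module PointSet (X : Subset v) where

    x : Fin b → ℕ
    x j = ∣ X ∩ B j ∣

    n : Fin b → ℕ
    n j = χ (NP B X) j

    Q : ℕ
    Q = ∑[ j < b ] (x j * x j)

    first-moment : ∑[ j < b ] x j ≡ ∣ X ∣ * r
    first-moment = incidences X

    second-moment : Q + lam * ∣ X ∣ ≡ lam * (∣ X ∣ * ∣ X ∣) + r * ∣ X ∣
    second-moment = subst (λ Z → Q + lam * ∣ Z ∣ ≡ lam * (∣ X ∣ * ∣ X ∣) + r * ∣ Z ∣) (∩-idem X)
                          (intersection-pairs X X)

    n-on-N : ∀ c {j} → j ∈ NP B X → c * n j ≡ c
    n-on-N c j∈N = trans (cong (c *_) (χ-∈ j∈N)) (*-identityʳ c)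

    x-supported : ∀ j → x j * n j ≡ x j
    x-supported j with meets-or-misses X j
    ... | inj₁ j∈N = n-on-N (x j) j∈N
    ... | inj₂ (_ , x≡0) = trans (cong (_* n j) x≡0) (sym x≡0)

    linear-total : ∀ m → ∑[ j < b ] ((2 * m + 1) * x j) ≡ (2 * m + 1) * (∣ X ∣ * r)
    linear-total m = trans (sym (*-distribˡ-sum (2 * m + 1) x)) (cong ((2 * m + 1) *_) first-moment)

    quadratic-total : ∀ c → ∑[ j < b ] (x j * x j + c * n j) ≡ Q + ∣ NP B X ∣ * c
    quadratic-total c = begin
      ∑[ j < b ] (x j * x j + c * n j)   ≡⟨ ∑-distrib-+ (λ j → x j * x j) (λ j → c * n j) ⟩
      Q + ∑[ j < b ] (c * n j)           ≡⟨ cong (Q +_) (*-distribˡ-sum c n) ⟨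
      Q + c * sum n                      ≡⟨ cong (λ t → Q + c * t) (card-sum (NP B X)) ⟨
      Q + c * ∣ NP B X ∣                 ≡⟨ cong (Q +_) (*-comm c ∣ NP B X ∣) ⟩
      Q + ∣ NP B X ∣ * c                 ∎
      where open ≡-Reasoning

    -- First bound: Σⱼ (xⱼ − m)(xⱼ − m − 1) ≥ 0 over the blocks of N(X).
    first-bound : ∀ m → (2 * m + 1) * (∣ X ∣ * r) ≤ Q + ∣ NP B X ∣ * (m * (m + 1))
    first-bound m = subst₂ _≤_ (linear-total m) (quadratic-total (m * (m + 1))) (sum-mono pointwise)
      where
      open ≤-Reasoning
      pointwise : ∀ j → (2 * m + 1) * x j ≤ x j * x j + m * (m + 1) * n j
      pointwise j with meets-or-misses X j
      ... | inj₁ j∈N = begin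
        (2 * m + 1) * x j               ≤⟨ consecutive-product m (x j) ⟩
        x j * x j + m * (m + 1)         ≡⟨ cong (x j * x j +_) (n-on-N (m * (m + 1)) j∈N) ⟨
        x j * x j + m * (m + 1) * n j   ∎
      ... | inj₂ (_ , x≡0) = begin
        (2 * m + 1) * x j               ≡⟨ cong ((2 * m + 1) *_) x≡0 ⟩
        (2 * m + 1) * 0                 ≡⟨ *-zeroʳ (2 * m + 1) ⟩
        0                               ≤⟨ z≤n ⟩
        x j * x j + m * (m + 1) * n j   ∎

    first-bound-tight : ∀ m → (∀ j → j ∈ NP B X → x j ≡ m ⊎ x j ≡ suc m) →
                        (2 * m + 1) * (∣ X ∣ * r) ≡ Q + ∣ NP B X ∣ * (m * (m + 1))
    first-bound-tight m roots =
      trans (sym (linear-total m)) (trans (sum-cong-≗ pointwise) (quadratic-total (m * (m + 1))))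
      where
      open ≡-Reasoning
      pointwise : ∀ j → (2 * m + 1) * x j ≡ x j * x j + m * (m + 1) * n j
      pointwise j with meets-or-misses X j
      ... | inj₁ j∈N = begin
        (2 * m + 1) * x j               ≡⟨ consecutive-product-roots m (x j) (roots j j∈N) ⟩
        x j * x j + m * (m + 1)         ≡⟨ cong (x j * x j +_) (n-on-N (m * (m + 1)) j∈N) ⟨
        x j * x j + m * (m + 1) * n j   ∎
      ... | inj₂ (j∉N , x≡0) = begin
        (2 * m + 1) * x j
          ≡⟨ cong ((2 * m + 1) *_) x≡0 ⟩
        (2 * m + 1) * 0
          ≡⟨ solve 2 (λ m c → (con 2 :* m :+ con 1) :* con 0 := con 0 :* con 0 :+ c :* con 0) refl m (m * (m + 1)) ⟩
        0 * 0 + m * (m + 1) * 0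
          ≡⟨ cong₂ (λ y z → y * y + m * (m + 1) * z) x≡0 (χ-∉ j∉N) ⟨
        x j * x j + m * (m + 1) * n j ∎

    -- Second bound: Cauchy–Schwarz (Σ xⱼ)² ≤ |N(X)| Σ xⱼ², divided by |X|.
    second-bound : r * r * ∣ X ∣ + ∣ NP B X ∣ * lam ≤ ∣ NP B X ∣ * (r + lam * ∣ X ∣)
    second-bound = divide-by-size {N = ∣ NP B X ∣} λ≤r
      (subst₂ _≤_ (cong₂ _*_ total total) (cong (Q *_) size) (cauchy-schwarz x n)) second-moment
      where
      total : ∑[ j < b ] (x j * n j) ≡ ∣ X ∣ * r
      total = trans (sum-cong-≗ x-supported) first-moment
      size : ∑[ j < b ] (n j * n j) ≡ ∣ NP B X ∣
      size = trans (sum-cong-≗ (χ-idem (NP B X))) (sym (card-sum (NP B X)))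

  module BlockSet (Y : Subset b) where

    W : Subset v
    W = ∁ (NB B Y)

    N[W]⊆∁Y : NP B W ⊆ ∁ Y
    N[W]⊆∁Y j∈N[W] = x∉p⇒x∈∁p (λ j∈Y →
      avoids-blocks x∈∁p⇒x∉p j∈Y (∈-select⁻ (λ j → nonempty? (W ∩ B j)) j∈N[W]))

    -- Third bound (in ℕ): the second bound for W, with |N(W)| enlarged to |∁ Y|.
    third-bound : r * r * ∣ W ∣ + ∣ ∁ Y ∣ * lam ≤ ∣ ∁ Y ∣ * (r + lam * ∣ W ∣)
    third-bound = enlarge (PointSet.second-bound W) (p⊆q⇒∣p∣≤∣q∣ N[W]⊆∁Y)
                          (≤-trans λ≤r (m≤m+n r (lam * ∣ W ∣)))

  module Separated (X : Subset v) (Y : Subset b) where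

    W′ : Subset v
    W′ = ∁ (X ∪ NB B Y)

    W′-avoids-X : ∀ {p} → p ∈ X → p ∉ W′
    W′-avoids-X p∈X p∈W′ = x∈∁p⇒x∉p p∈W′ (x∈p∪q⁺ (inj₁ p∈X))

    W′-avoids-NB : ∀ {p} → p ∈ W′ → p ∉ NB B Y
    W′-avoids-NB p∈W′ p∈NB = x∈∁p⇒x∉p p∈W′ (x∈p∪q⁺ (inj₂ p∈NB))

    x y e : Fin b → ℕ
    x j = ∣ X ∩ B j ∣
    y j = ∣ W′ ∩ B j ∣
    e j = χ (NP B X ─ Y) j

    X∩W′-empty : ∀ c → c * ∣ X ∩ W′ ∣ ≡ 0
    X∩W′-empty c = trans (cong (c *_) (empty-card disjoint)) (*-zeroʳ c)
      where
      disjoint : ¬ Nonempty (X ∩ W′)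
      disjoint (p , p∈X∩W′) with x∈p∩q⁻ X W′ p∈X∩W′
      ... | p∈X , p∈W′ = W′-avoids-X p∈X p∈W′

    fits : ∀ j → x j + y j ≤ k
    fits j = subst (x j + y j ≤_) (blockSize j) (disjoint-in-block W′-avoids-X j)

    cross-moment : ∑[ j < b ] (x j * y j) ≡ lam * (∣ X ∣ * ∣ W′ ∣)
    cross-moment = begin
      ∑[ j < b ] (x j * y j)
        ≡⟨ +-identityʳ _ ⟨
      ∑[ j < b ] (x j * y j) + 0
        ≡⟨ cong (∑[ j < b ] (x j * y j) +_) (X∩W′-empty lam) ⟨
      ∑[ j < b ] (x j * y j) + lam * ∣ X ∩ W′ ∣
        ≡⟨ intersection-pairs X W′ ⟩
      lam * (∣ X ∣ * ∣ W′ ∣) + r * ∣ X ∩ W′ ∣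
        ≡⟨ cong (lam * (∣ X ∣ * ∣ W′ ∣) +_) (X∩W′-empty r) ⟩
      lam * (∣ X ∣ * ∣ W′ ∣) + 0
        ≡⟨ +-identityʳ _ ⟩
      lam * (∣ X ∣ * ∣ W′ ∣) ∎
      where open ≡-Reasoning

    -- 4 xⱼ yⱼ ≤ (xⱼ + yⱼ)² ≤ k² on the blocks of N(X) ∖ Y, while xⱼ yⱼ = 0 on
    -- the blocks of Y (W′ avoids N(Y)) and off N(X) (there xⱼ = 0).
    block-bound : ∀ j → 4 * (x j * y j) ≤ k * k * e j
    block-bound j with j ∈? Y
    ... | yes j∈Y = begin
      4 * (x j * y j)   ≡⟨ cong (λ t → 4 * (x j * t)) (empty-card (avoids-blocks W′-avoids-NB j∈Y)) ⟩
      4 * (x j * 0)     ≡⟨ cong (4 *_) (*-zeroʳ (x j)) ⟩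
      0                 ≤⟨ z≤n ⟩
      k * k * e j       ∎
      where open ≤-Reasoning
    ... | no j∉Y with meets-or-misses X j
    ...   | inj₂ (_ , x≡0) = begin
      4 * (x j * y j)   ≡⟨ cong (λ t → 4 * (t * y j)) x≡0 ⟩
      4 * (0 * y j)     ≤⟨ z≤n ⟩
      k * k * e j       ∎
      where open ≤-Reasoning
    ...   | inj₁ j∈N = begin
      4 * (x j * y j)              ≤⟨ four-ab (x j) (y j) ⟩
      (x j + y j) * (x j + y j)    ≤⟨ *-mono-≤ (fits j) (fits j) ⟩
      k * k                        ≡⟨ *-identityʳ (k * k) ⟨
      k * k * 1                    ≡⟨ cong (k * k *_) (χ-∈ (∈-─⁺ (NP B X) Y j∈N j∉Y)) ⟨
      k * k * e j                  ∎
      where open ≤-Reasoning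

    fourth-bound : 4 * lam * ∣ X ∣ * ∣ W′ ∣ ≤ ∣ NP B X ─ Y ∣ * (k * k)
    fourth-bound = subst₂ _≤_ total-left total-right (sum-mono block-bound)
      where
      total-left : ∑[ j < b ] (4 * (x j * y j)) ≡ 4 * lam * ∣ X ∣ * ∣ W′ ∣
      total-left = trans (sym (*-distribˡ-sum 4 (λ j → x j * y j)))
        (trans (cong (4 *_) cross-moment)
               (solve 3 (λ l s w → con 4 :* (l :* (s :* w)) := con 4 :* l :* s :* w) refl lam ∣ X ∣ ∣ W′ ∣))
      total-right : ∑[ j < b ] (k * k * e j) ≡ ∣ NP B X ─ Y ∣ * (k * k)
      total-right = trans (sym (*-distribˡ-sum (k * k) e))
        (trans (cong (k * k *_) (sym (card-sum (NP B X ─ Y)))) (*-comm (k * k) _))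

-- The statement is phrased over ℤ (it involves
-- λ(|X| − 1) and b − |Y|); each ℕ-valued estimate above is transported along
-- the embedding +_ : ℕ → ℤ, which preserves sums definitionally and products
-- by pos-*, and rearranged by the ring solver.
module IntegerForms where

  open import Data.Nat as ℕ using (_≤_)
  open import Data.Integer as ℤ using (ℤ; +_; _*_; _-_; 1ℤ; 0ℤ; +≤+) renaming (_≤_ to _≤ℤ_)
  open import Data.Integer.Properties using (pos-*; +-inverseʳ; +-identityʳ; i≤j⇒0≤j-i; 0≤i-j⇒j≤i; i-j≡0⇒i≡j)
  open import Relation.Binary.PropositionalEquality using (_≡_; refl; sym; trans; cong; cong₂; subst; subst₂)
  open import Data.Integer.Solver using (module +-*-Solver)
  open +-*-Solver

  vanish : ∀ {a b : ℤ} → a ≡ b → b - a ≡ 0ℤ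
  vanish {b = b} refl = +-inverseʳ b

  ≤-by-difference : ∀ {x y d e : ℤ} → 0ℤ ≤ℤ d → y - x ≡ d ℤ.+ e → e ≡ 0ℤ → x ≤ℤ y
  ≤-by-difference {d = d} 0≤d y-x≡d+e e≡0 =
    0≤i-j⇒j≤i (subst (0ℤ ≤ℤ_) (sym (trans y-x≡d+e (trans (cong (λ t → d ℤ.+ t) e≡0) (+-identityʳ d)))) 0≤d)

  ≡-by-difference : ∀ {x y d e : ℤ} → d ≡ 0ℤ → y - x ≡ d ℤ.+ e → e ≡ 0ℤ → x ≡ y
  ≡-by-difference {x} {y} d≡0 y-x≡d+e e≡0 = sym (i-j≡0⇒i≡j y x (trans y-x≡d+e (cong₂ ℤ._+_ d≡0 e≡0)))

  -- The identity behind the first bound: with Q = Σⱼ xⱼ²,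
  -- N m(m+1) − (2rm − λ(s−1)) s
  --   = [Q + N m(m+1) − (2m+1) s r] + [λ s² + r s − (Q + λ s)].
  first-difference : ∀ (r m lam s N Q : ℤ) →
    N * (m * (m ℤ.+ 1ℤ)) - (+ 2 * r * m - lam * (s - 1ℤ)) * s
      ≡ (Q ℤ.+ N * (m * (m ℤ.+ 1ℤ)) - (+ 2 * m ℤ.+ 1ℤ) * (s * r)) ℤ.+ (lam * (s * s) ℤ.+ r * s - (Q ℤ.+ lam * s))
  first-difference = solve 6 (λ r m lam s N Q →
    N :* (m :* (m :+ con 1ℤ)) :- (con (+ 2) :* r :* m :- lam :* (s :- con 1ℤ)) :* s
      := (Q :+ N :* (m :* (m :+ con 1ℤ)) :- (con (+ 2) :* m :+ con 1ℤ) :* (s :* r))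
         :+ (lam :* (s :* s) :+ r :* s :- (Q :+ lam :* s))) refl

  cast-linear : ∀ r m s → + ((2 ℕ.* m ℕ.+ 1) ℕ.* (s ℕ.* r)) ≡ (+ 2 * + m ℤ.+ 1ℤ) * (+ s * + r)
  cast-linear r m s = trans (pos-* (2 ℕ.* m ℕ.+ 1) (s ℕ.* r))
                            (cong₂ _*_ (cong (λ t → t ℤ.+ 1ℤ) (pos-* 2 m)) (pos-* s r))

  cast-quadratic : ∀ m N Q → + (Q ℕ.+ N ℕ.* (m ℕ.* (m ℕ.+ 1))) ≡ + Q ℤ.+ + N * (+ m * (+ m ℤ.+ 1ℤ))
  cast-quadratic m N Q =
    cong (λ t → + Q ℤ.+ t) (trans (pos-* N (m ℕ.* (m ℕ.+ 1))) (cong (+ N *_) (pos-* m (m ℕ.+ 1))))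

  cast-second-moment : ∀ r lam s Q → Q ℕ.+ lam ℕ.* s ≡ lam ℕ.* (s ℕ.* s) ℕ.+ r ℕ.* s →
                       + Q ℤ.+ + lam * + s ≡ + lam * (+ s * + s) ℤ.+ + r * + s
  cast-second-moment r lam s Q e =
    trans (cong (λ t → + Q ℤ.+ t) (sym (pos-* lam s)))
      (trans (cong +_ e) (cong₂ ℤ._+_ (trans (pos-* lam (s ℕ.* s)) (cong (+ lam *_) (pos-* s s))) (pos-* r s)))

  cast-size-bound : ∀ r lam s N → r ℕ.* r ℕ.* s ℕ.+ N ℕ.* lam ≤ N ℕ.* (r ℕ.+ lam ℕ.* s) →
                    + r * + r * + s ℤ.+ + N * + lam ≤ℤ + N * (+ r ℤ.+ + lam * + s)
  cast-size-bound r lam s N h = subst₂ _≤ℤ_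
    (cong₂ ℤ._+_ (trans (pos-* (r ℕ.* r) s) (cong (_* + s) (pos-* r r))) (pos-* N lam))
    (trans (pos-* N (r ℕ.+ lam ℕ.* s)) (cong (λ t → + N * (+ r ℤ.+ t)) (pos-* lam s)))
    (+≤+ h)

  first-bound-ℤ : ∀ r m lam s N Q →
    (2 ℕ.* m ℕ.+ 1) ℕ.* (s ℕ.* r) ≤ Q ℕ.+ N ℕ.* (m ℕ.* (m ℕ.+ 1)) →
    Q ℕ.+ lam ℕ.* s ≡ lam ℕ.* (s ℕ.* s) ℕ.+ r ℕ.* s →
    (+ 2 * + r * + m - + lam * (+ s - 1ℤ)) * + s ≤ℤ + N * (+ m * (+ m ℤ.+ 1ℤ))
  first-bound-ℤ r m lam s N Q h e = ≤-by-difference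
    (i≤j⇒0≤j-i (subst₂ _≤ℤ_ (cast-linear r m s) (cast-quadratic m N Q) (+≤+ h)))
    (first-difference (+ r) (+ m) (+ lam) (+ s) (+ N) (+ Q))
    (vanish (cast-second-moment r lam s Q e))

  first-bound-tight-ℤ : ∀ r m lam s N Q →
    (2 ℕ.* m ℕ.+ 1) ℕ.* (s ℕ.* r) ≡ Q ℕ.+ N ℕ.* (m ℕ.* (m ℕ.+ 1)) →
    Q ℕ.+ lam ℕ.* s ≡ lam ℕ.* (s ℕ.* s) ℕ.+ r ℕ.* s →
    (+ 2 * + r * + m - + lam * (+ s - 1ℤ)) * + s ≡ + N * (+ m * (+ m ℤ.+ 1ℤ))
  first-bound-tight-ℤ r m lam s N Q h e = ≡-by-difference
    (vanish (trans (sym (cast-linear r m s)) (trans (cong +_ h) (cast-quadratic m N Q))))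
    (first-difference (+ r) (+ m) (+ lam) (+ s) (+ N) (+ Q))
    (vanish (cast-second-moment r lam s Q e))

  second-bound-ℤ : ∀ r lam s N → r ℕ.* r ℕ.* s ℕ.+ N ℕ.* lam ≤ N ℕ.* (r ℕ.+ lam ℕ.* s) →
                   + r * + r * + s ≤ℤ + N * (+ r ℤ.+ + lam * (+ s - 1ℤ))
  second-bound-ℤ r lam s N h = ≤-by-difference (i≤j⇒0≤j-i (cast-size-bound r lam s N h))
    (solve 4 (λ r lam s N → N :* (r :+ lam :* (s :- con 1ℤ)) :- r :* r :* s
                          := (N :* (r :+ lam :* s) :- (r :* r :* s :+ N :* lam)) :+ con 0ℤ) refl (+ r) (+ lam) (+ s) (+ N))
    refl

  -- |N(Y)| (r² − λ(b − |Y|)) ≥ rk |Y|, from the size bound for the points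
  -- W outside N(Y) and the counting identities bk = vr, rk + λ = λv + r.
  third-bound-ℤ : ∀ {v b} k lam r z w y c → z ℕ.+ w ≡ v → y ℕ.+ c ≡ b →
    b ℕ.* k ≡ v ℕ.* r → r ℕ.* k ℕ.+ lam ≡ lam ℕ.* v ℕ.+ r →
    r ℕ.* r ℕ.* w ℕ.+ c ℕ.* lam ≤ c ℕ.* (r ℕ.+ lam ℕ.* w) →
    + r * + k * + y ≤ℤ + z * (+ r * + r - + lam * (+ b - + y))
  third-bound-ℤ k lam r z w y c refl refl bk≡vr rk+λ≡λv+r h =
    ≤-by-difference (i≤j⇒0≤j-i (cast-size-bound r lam w c h))
      (solve 7 (λ r k lam z w y c →
         z :* (r :* r :- lam :* ((y :+ c) :- y)) :- r :* k :* y
           := (c :* (r :+ lam :* w) :- (r :* r :* w :+ c :* lam))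
              :+ (r :* ((z :+ w) :* r :- (y :+ c) :* k) :- c :* ((lam :* (z :+ w) :+ r) :- (r :* k :+ lam))))
         refl (+ r) (+ k) (+ lam) (+ z) (+ w) (+ y) (+ c))
      (trans (cong₂ (λ d e → + r * d - + c * e) (vanish bk≡vr-ℤ) (vanish rk+λ≡λv+r-ℤ))
             (solve 2 (λ r c → r :* con 0ℤ :- c :* con 0ℤ := con 0ℤ) refl (+ r) (+ c)))
    where
    bk≡vr-ℤ : (+ y ℤ.+ + c) * + k ≡ (+ z ℤ.+ + w) * + r
    bk≡vr-ℤ = trans (sym (pos-* (y ℕ.+ c) k)) (trans (cong +_ bk≡vr) (pos-* (z ℕ.+ w) r))
    rk+λ≡λv+r-ℤ : + r * + k ℤ.+ + lam ≡ + lam * (+ z ℤ.+ + w) ℤ.+ + r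
    rk+λ≡λv+r-ℤ = trans (cong (λ t → t ℤ.+ + lam) (sym (pos-* r k)))
                    (trans (cong +_ rk+λ≡λv+r) (cong (λ t → t ℤ.+ + r) (pos-* lam (z ℕ.+ w))))

  fourth-bound-ℤ : ∀ k lam s w E → 4 ℕ.* lam ℕ.* s ℕ.* w ≤ E ℕ.* (k ℕ.* k) →
                   + 4 * + lam * + s * + w ≤ℤ + E * (+ k * + k)
  fourth-bound-ℤ k lam s w E h = subst₂ _≤ℤ_
    (trans (pos-* (4 ℕ.* lam ℕ.* s) w) (cong (_* + w) (trans (pos-* (4 ℕ.* lam) s) (cong (_* + s) (pos-* 4 lam)))))
    (trans (pos-* E (k ℕ.* k)) (cong (+ E *_) (pos-* k k)))
    (+≤+ h)

open import Data.Nat using (ℕ; suc; _≤_)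
open import Data.Fin using (Fin)
open import Data.Fin.Subset using (Subset; _∈_; _∩_; _∪_; _─_; ∣_∣; ∁)
open import Data.Integer using (ℤ; +_; _*_; _-_; 1ℤ) renaming (_≤_ to _≤ℤ_)
open import Data.Product using (_×_; _,_)
open import Data.Sum using (_⊎_)
open import Relation.Binary.PropositionalEquality using (_≡_)
open Indicators using (card-complement)
open IntegerForms

theorem2p1 : (v k lam b r : ℕ) (B : Fin b → Subset v) → IsDesign v k lam b B →
    (∀ p → ∣ blocksThrough B p ∣ ≡ r) →
    (m : ℕ) → 1 ≤ m → (X : Subset v) → (Y : Subset b) →
    -- |N(X)| ≥ (2rm − lam(|X|−1)) / (m(m+1)) · |X|
    ((+ 2 * + r * + m - + lam * (+ ∣ X ∣ - 1ℤ)) * + ∣ X ∣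
        ≤ℤ + ∣ NP B X ∣ * (+ m * (+ m Data.Integer.+ 1ℤ)))
    -- |N(X)| ≥ r² / (r + lam(|X|−1)) · |X|
    × (+ r * + r * + ∣ X ∣
        ≤ℤ + ∣ NP B X ∣ * (+ r Data.Integer.+ + lam * (+ ∣ X ∣ - 1ℤ)))
    -- |N(Y)| ≥ rk / (r² − lam(b−|Y|)) · |Y|
    × (+ r * + k * + ∣ Y ∣
        ≤ℤ + ∣ NB B Y ∣ * (+ r * + r - + lam * (+ b - + ∣ Y ∣)))
    -- |N(X) \ Y| ≥ 4λ/k² · |X| · |P \ (X ∪ N(Y))|
    × (+ 4 * + lam * + ∣ X ∣ * + ∣ ∁ (X ∪ NB B Y) ∣
        ≤ℤ + ∣ NP B X ─ Y ∣ * (+ k * + k))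
    -- equality in the first bound when every block of N(X) meets X in m or m+1 points
    × ((∀ j → j ∈ NP B X → ∣ X ∩ B j ∣ ≡ m ⊎ ∣ X ∩ B j ∣ ≡ suc m) →
       (+ 2 * + r * + m - + lam * (+ ∣ X ∣ - 1ℤ)) * + ∣ X ∣
         ≡ + ∣ NP B X ∣ * (+ m * (+ m Data.Integer.+ 1ℤ)))
theorem2p1 v k lam b r B D R m _ X Y =
    first-bound-ℤ r m lam (∣ X ∣) (∣ NP B X ∣) Q (first-bound m) second-moment
  , second-bound-ℤ r lam (∣ X ∣) (∣ NP B X ∣) second-bound
  , third-bound-ℤ k lam r (∣ NB B Y ∣) (∣ W ∣) (∣ Y ∣) (∣ ∁ Y ∣)
      (card-complement (NB B Y)) (card-complement Y) bk≡vr rk+λ≡λv+r third-bound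
  , fourth-bound-ℤ k lam (∣ X ∣) (∣ W′ ∣) (∣ NP B X ─ Y ∣) fourth-bound
  , λ tight → first-bound-tight-ℤ r m lam (∣ X ∣) (∣ NP B X ∣) Q (first-bound-tight m tight) second-moment
  where
  open Design D R
  open PointSet X
  open BlockSet Y
  open Separated X Y using (W′; fourth-bound)
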